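{- Let $\mathcal{M}$ be the Bose--Mesner algebra of a commutative $d$-class association scheme on $X$, and let $A\in\mathcal{M}$. (i) If $A$ is a symmetric $01$-matrix with $d+1$ distinct eigenvalues, then $A$ is the adjacency matrix of a connected undirected graph. (ii) If $A$ is a non-symmetric $01$-matrix with $d+1$ distinct eigenvalues, then $A$ is the adjacency matrix of a strongly connected directed graph.
   Context: A commutative $d$-class association scheme on a finite set $X$ has nonempty relations with $01$ adjacency matrices $A_0,\dots,A_d$ satisfying $A_0=I$, $\sum_iA_i=J$, $A_i^\top\in\{A_0,\dots,A_d\}$, each $A_iA_j$ a linear combination of the $A_k$, and $A_iA_j=A_jA_i$; $\mathcal{M}=\mathrm{span}\{A_0,\dots,A_d\}$. A $01$-matrix $A$ indexed by $X$ is the adjacency matrix of the (directed) graph on $X$ with an arc $x\to y$ iff $A_{xy}=1$. -}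

module Defs where

open import Level using (Level; _⊔_)
open import Data.Nat using (ℕ; zero; suc)
open import Data.Fin using (Fin; toℕ) renaming (zero to fzero; suc to fsuc)
open import Data.Bool using (Bool; true; false)
open import Data.Product using (Σ; ∃; _×_; _,_)
open import Relation.Nullary using (¬_)
import Relation.Nullary.Decidable
import Data.Fin
open import Relation.Binary.PropositionalEquality using (_≡_)
open import Algebra.Bundles using (CommutativeRing)

data Reachable {n : ℕ} (A : Fin n → Fin n → Bool) : Fin n → Fin n → Set where
  here  : ∀ {x} → Reachable A x x
  step  : ∀ {x y z} → A x y ≡ true → Reachable A y z → Reachable A x z

-- Strongly connected (for symmetric A: connected undirected graph).
StronglyConnected : {n : ℕ} → (Fin n → Fin n → Bool) → Set
StronglyConnected {n} A = ∀ (x y : Fin n) → Reachable A x y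

Symmetric01 : {n : ℕ} → (Fin n → Fin n → Bool) → Set
Symmetric01 {n} A = ∀ (x y : Fin n) → A x y ≡ A y x

module Over {c ℓ : Level} (R : CommutativeRing c ℓ) where
  open CommutativeRing R

  Σ[_] : (m : ℕ) → (Fin m → Carrier) → Carrier
  Σ[ zero ] f = 0#
  Σ[ suc m ] f = f fzero + Σ[ m ] (λ i → f (fsuc i))

  ⟦_⟧ : Bool → Carrier
  ⟦ true ⟧ = 1#
  ⟦ false ⟧ = 0#

  fromℕ : ℕ → Carrier
  fromℕ zero = 0#
  fromℕ (suc m) = 1# + fromℕ m

  pow : Carrier → ℕ → Carrier
  pow x zero = 1#
  pow x (suc m) = x * pow x m

  IsField : Set (c ⊔ ℓ)
  IsField = ¬ (1# ≈ 0#) × (∀ x → ¬ (x ≈ 0#) → ∃ λ y → x * y ≈ 1#)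

  CharZero : Set ℓ
  CharZero = ∀ (m : ℕ) → ¬ (fromℕ (suc m) ≈ 0#)

  AlgClosed : Set (c ⊔ ℓ)
  AlgClosed = ∀ (m : ℕ) (a : Fin (suc m) → Carrier) →
    ∃ λ x → pow x (suc m) + Σ[ suc m ] (λ i → a i * pow x (toℕ i)) ≈ 0#

  prod : {n : ℕ} → (Fin n → Fin n → Bool) → (Fin n → Fin n → Bool) → Fin n → Fin n → Carrier
  prod {n} B C x y = Σ[ n ] (λ z → ⟦ B x z ⟧ * ⟦ C z y ⟧)

  record IsCommAssocScheme (n d : ℕ) (Ai : Fin (suc d) → Fin n → Fin n → Bool) : Set (c ⊔ ℓ) where
    field
      nonempty  : ∀ i → ∃ λ x → ∃ λ y → Ai i x y ≡ true
      identity  : ∀ (x y : Fin n) → ⟦ Ai fzero x y ⟧ ≈ ⟦ Relation.Nullary.Decidable.does (Data.Fin._≟_ x y) ⟧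
      sumJ      : ∀ (x y : Fin n) → Σ[ suc d ] (λ i → ⟦ Ai i x y ⟧) ≈ 1#
      transpose : ∀ i → ∃ λ j → ∀ (x y : Fin n) → Ai i y x ≡ Ai j x y
      closed    : ∀ i j → ∃ λ (p : Fin (suc d) → Carrier) →
                    ∀ (x y : Fin n) → prod (Ai i) (Ai j) x y ≈ Σ[ suc d ] (λ k → p k * ⟦ Ai k x y ⟧)
      commute   : ∀ i j (x y : Fin n) → prod (Ai i) (Ai j) x y ≈ prod (Ai j) (Ai i) x y

  InBM : {n d : ℕ} → (Fin (suc d) → Fin n → Fin n → Bool) → (Fin n → Fin n → Bool) → Set (c ⊔ ℓ)
  InBM {n} {d} Ai A = ∃ λ (γ : Fin (suc d) → Carrier) →
    ∀ (x y : Fin n) → ⟦ A x y ⟧ ≈ Σ[ suc d ] (λ k → γ k * ⟦ Ai k x y ⟧)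

  IsEigenvalue : {n : ℕ} → (Fin n → Fin n → Bool) → Carrier → Set (c ⊔ ℓ)
  IsEigenvalue {n} A λ₀ = ∃ λ (v : Fin n → Carrier) →
    ¬ (∀ i → v i ≈ 0#) × (∀ i → Σ[ n ] (λ j → ⟦ A i j ⟧ * v j) ≈ λ₀ * v i)

  HasDistinctEigenvalues : {n : ℕ} → (Fin n → Fin n → Bool) → ℕ → Set (c ⊔ ℓ)
  HasDistinctEigenvalues A m = ∃ λ (e : Fin m → Carrier) →
    (∀ i j → e i ≈ e j → i ≡ j) × (∀ k → IsEigenvalue A (e k)) ×
    (∀ μ → IsEigenvalue A μ → ∃ λ k → μ ≈ e k)

-- If no walk of length at most d joins x to y, then the (x,y)-entries of I, A, …, Aᵈ all
-- vanish. These d + 1 matrices lie in the Bose–Mesner algebra, whose coordinates with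
-- respect to A₀, …, A_d place them in the kernel of the nonzero functional M ↦ M x y; so
-- some nontrivial combination q(A) = Σ cⱼ Aʲ is the zero matrix. Then q, of degree at most
-- d, vanishes at the d + 1 distinct eigenvalues of A, hence q = 0: a contradiction. Equality
-- in F is not decidable, so the argument runs in the double-negation monad; the existence
-- of a short walk is decidable, which gets us out again.
module Submission where

open import Defs
open import Level using (Level; _⊔_)
open import Data.Nat using (ℕ; zero; suc)
open import Data.Fin using (Fin; toℕ; punchIn; punchOut) renaming (zero to fzero; suc to fsuc)
import Data.Fin.Properties as Fin
open import Data.Bool using (Bool; true; false)
import Data.Bool.Properties as Bool
open import Data.Product using (∃; _×_; _,_; proj₁; proj₂)
open import Data.Maybe using (nothing)
open import Data.Empty using (⊥-elim)
open import Data.Vec.Functional using (insertAt)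
open import Data.Vec.Functional.Properties using (insertAt-lookup; insertAt-punchIn)
open import Effect.Monad using (RawMonad)
open import Function using (_∘_)
open import Relation.Nullary using (¬_; Dec; yes; no; does)
open import Relation.Nullary.Decidable using (_×-dec_; dec-true; dec-false; decidable-stable; ¬¬-excluded-middle)
open import Relation.Nullary.Negation using (¬¬-Monad; ¬¬-map)
open import Relation.Binary.PropositionalEquality as ≡ using (_≡_; _≢_)
open import Algebra.Bundles using (CommutativeRing)
open import Algebra.Solver.Ring.AlmostCommutativeRing
  using (fromCommutativeRing; AlmostCommutativeRing; -raw-almostCommutative⟶)
import Algebra.Solver.Ring as RingSolver

¬¬-∀ : ∀ {a n} {P : Fin n → Set a} → (∀ i → ¬ ¬ P i) → ¬ ¬ (∀ i → P i)
¬¬-∀ = Fin.sequence (RawMonad.rawApplicative ¬¬-Monad)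

module _ {n : ℕ} (A : Fin n → Fin n → Bool) where

  Walk : ℕ → Fin n → Fin n → Set
  Walk zero    x y = x ≡ y
  Walk (suc j) x y = ∃ λ z → A x z ≡ true × Walk j z y

  walk? : ∀ j x y → Dec (Walk j x y)
  walk? zero    x y = x Fin.≟ y
  walk? (suc j) x y = Fin.any? (λ z → (A x z Bool.≟ true) ×-dec walk? j z y)

  walk⇒reachable : ∀ j {x y} → Walk j x y → Reachable A x y
  walk⇒reachable zero    ≡.refl         = here
  walk⇒reachable (suc j) (z , xz , zy) = step xz (walk⇒reachable j zy)

module _ {c ℓ : Level} (F : CommutativeRing c ℓ) where

  open CommutativeRing F
  open Over F
  open import Algebra.Properties.Semiring.Sum semiring
    using (sum; sum-cong-≋; sum-replicate-zero; sum-remove; ∑-comm; ∑-distrib-+; *-distribˡ-sum; *-distribʳ-sum)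
  open import Algebra.Properties.CommutativeSemigroup *-commutativeSemigroup
    using (x∙yz≈y∙xz)
  open import Algebra.Properties.Ring ring using (-‿distribˡ-*)
  open import Algebra.Properties.Group +-group using (x∙y⁻¹≈ε⇒x≈y)
  open import Relation.Binary.Reasoning.Setoid setoid
  private
    ring′ : AlmostCommutativeRing c ℓ
    ring′ = fromCommutativeRing F
  open RingSolver (AlmostCommutativeRing.rawRing ring′) ring′ (-raw-almostCommutative⟶ ring′) (λ _ _ → nothing)
    using (solve; _:+_; _:*_; _:=_)

  Σ≈sum : ∀ m (f : Fin m → Carrier) → Σ[ m ] f ≈ sum f
  Σ≈sum zero    f = refl
  Σ≈sum (suc m) f = +-congˡ (Σ≈sum m (f ∘ fsuc))

  sum-zero : ∀ {m} {f : Fin m → Carrier} → (∀ i → f i ≈ 0#) → sum f ≈ 0#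
  sum-zero {m} f≈0 = trans (sum-cong-≋ f≈0) (sum-replicate-zero m)

  sum-single : ∀ {m} (f : Fin m → Carrier) k → (∀ i → i ≢ k → f i ≈ 0#) → sum f ≈ f k
  sum-single {suc m} f k f≈0 = begin
    sum f                               ≈⟨ sum-remove f ⟩
    f k + sum (f ∘ punchIn k)           ≈⟨ +-congˡ (sum-zero (λ i → f≈0 (punchIn k i) (Fin.punchInᵢ≢i k i))) ⟩
    f k + 0#                            ≈⟨ +-identityʳ (f k) ⟩
    f k                                 ∎

  ∑-∑-assoc : ∀ {m p} (γ : Fin m → Carrier) (β : Fin m → Fin p → Carrier) (w : Fin p → Carrier) →
    sum (λ j → γ j * sum (λ k → β j k * w k)) ≈ sum (λ k → sum (λ j → γ j * β j k) * w k)
  ∑-∑-assoc γ β w = begin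
    sum (λ j → γ j * sum (λ k → β j k * w k))   ≈⟨ sum-cong-≋ (λ j → *-distribˡ-sum (γ j) (λ k → β j k * w k)) ⟩
    sum (λ j → sum (λ k → γ j * (β j k * w k))) ≈⟨ ∑-comm (λ j k → γ j * (β j k * w k)) ⟩
    sum (λ k → sum (λ j → γ j * (β j k * w k))) ≈⟨ sum-cong-≋ (λ k → sum-cong-≋ (λ j → sym (*-assoc (γ j) (β j k) (w k)))) ⟩
    sum (λ k → sum (λ j → (γ j * β j k) * w k)) ≈⟨ sum-cong-≋ (λ k → sym (*-distribʳ-sum (w k) (λ j → γ j * β j k))) ⟩
    sum (λ k → sum (λ j → γ j * β j k) * w k)   ∎

  ⟦true⟧≉0 : ¬ (1# ≈ 0#) → ∀ {b} → b ≡ true → ¬ (⟦ b ⟧ ≈ 0#)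
  ⟦true⟧≉0 1≉0 ≡.refl = 1≉0

  ⟦false⟧≈0 : ∀ {b} → b ≡ false → ⟦ b ⟧ ≈ 0#
  ⟦false⟧≈0 ≡.refl = refl

  Matrix : ℕ → Set c
  Matrix n = Fin n → Fin n → Carrier

  toMatrix : ∀ {n} → (Fin n → Fin n → Bool) → Matrix n
  toMatrix A x y = ⟦ A x y ⟧

  𝕀 : ∀ {n} → Matrix n
  𝕀 x y = ⟦ does (x Fin.≟ y) ⟧

  _⊗_ : ∀ {n} → Matrix n → Matrix n → Matrix n
  (M ⊗ N) x y = sum (λ z → M x z * N z y)

  _^_ : ∀ {n} → Matrix n → ℕ → Matrix n
  M ^ zero  = 𝕀
  M ^ suc j = M ⊗ (M ^ j)

  _·_ : ∀ {n} → Matrix n → (Fin n → Carrier) → Fin n → Carrier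
  (M · v) x = sum (λ y → M x y * v y)

  lincomb : ∀ {m n} → (Fin m → Carrier) → (Fin m → Matrix n) → Matrix n
  lincomb γ Ms x y = sum (λ k → γ k * Ms k x y)

  lincomb-congʳ : ∀ {m n} (γ : Fin m → Carrier) (Ms Ns : Fin m → Matrix n) x y →
    (∀ k → Ms k x y ≈ Ns k x y) → lincomb γ Ms x y ≈ lincomb γ Ns x y
  lincomb-congʳ γ Ms Ns x y Ms≈Ns = sum-cong-≋ (λ k → *-congˡ (Ms≈Ns k))

  lincomb-lincomb : ∀ {m p n} (γ : Fin m → Carrier) (β : Fin m → Fin p → Carrier) (Ns : Fin p → Matrix n) x y →
    lincomb γ (λ k → lincomb (β k) Ns) x y ≈ lincomb (λ r → sum (λ k → γ k * β k r)) Ns x y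
  lincomb-lincomb γ β Ns x y = ∑-∑-assoc γ β (λ r → Ns r x y)

  𝕀-· : ∀ {n} (v : Fin n → Carrier) x → (𝕀 · v) x ≈ v x
  𝕀-· v x = begin
    (𝕀 · v) x   ≈⟨ sum-single (λ y → 𝕀 x y * v y) x off-diagonal ⟩
    𝕀 x x * v x ≈⟨ *-congʳ (reflexive (≡.cong ⟦_⟧ (dec-true (x Fin.≟ x) ≡.refl))) ⟩
    1# * v x    ≈⟨ *-identityˡ (v x) ⟩
    v x         ∎
    where
    off-diagonal : ∀ y → y ≢ x → 𝕀 x y * v y ≈ 0#
    off-diagonal y y≢x = trans (*-congʳ (⟦false⟧≈0 (dec-false (x Fin.≟ y) (y≢x ∘ ≡.sym)))) (zeroˡ (v y))

  ⊗-· : ∀ {n} (M N : Matrix n) v x → ((M ⊗ N) · v) x ≈ (M · (N · v)) x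
  ⊗-· M N v x = sym (∑-∑-assoc (M x) N v)

  ·-scale : ∀ {n} (M : Matrix n) a v x → (M · (λ y → a * v y)) x ≈ a * (M · v) x
  ·-scale M a v x = trans (sum-cong-≋ (λ y → x∙yz≈y∙xz (M x y) a (v y))) (sym (*-distribˡ-sum a (λ y → M x y * v y)))

  lincomb-· : ∀ {m n} (γ : Fin m → Carrier) (Ms : Fin m → Matrix n) v x →
    (lincomb γ Ms · v) x ≈ sum (λ k → γ k * (Ms k · v) x)
  lincomb-· γ Ms v x = sym (∑-∑-assoc γ (λ k → Ms k x) v)

  ⊗-lincombˡ : ∀ {m n} (γ : Fin m → Carrier) (Ms : Fin m → Matrix n) N x y →
    (lincomb γ Ms ⊗ N) x y ≈ lincomb γ (λ k → Ms k ⊗ N) x y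
  ⊗-lincombˡ γ Ms N x y = sym (∑-∑-assoc γ (λ k → Ms k x) (λ z → N z y))

  ⊗-lincombʳ : ∀ {m n} M (β : Fin m → Carrier) (Ns : Fin m → Matrix n) x y →
    (M ⊗ lincomb β Ns) x y ≈ lincomb β (λ l → M ⊗ Ns l) x y
  ⊗-lincombʳ M β Ns x y = begin
    sum (λ z → M x z * sum (λ l → β l * Ns l z y))  ≈⟨ sum-cong-≋ (λ z → *-congˡ (sum-cong-≋ (λ l → *-comm (β l) (Ns l z y)))) ⟩
    sum (λ z → M x z * sum (λ l → Ns l z y * β l))  ≈⟨ ∑-∑-assoc (M x) (λ z l → Ns l z y) β ⟩
    sum (λ l → (M ⊗ Ns l) x y * β l)                ≈⟨ sum-cong-≋ (λ l → *-comm ((M ⊗ Ns l) x y) (β l)) ⟩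
    lincomb β (λ l → M ⊗ Ns l) x y                  ∎

  ^-eigen : ∀ {n} (M : Matrix n) v μ → (∀ x → (M · v) x ≈ μ * v x) →
    ∀ j x → ((M ^ j) · v) x ≈ pow μ j * v x
  ^-eigen M v μ Mv≈μv zero    x = trans (𝕀-· v x) (sym (*-identityˡ (v x)))
  ^-eigen M v μ Mv≈μv (suc j) x = begin
    ((M ⊗ (M ^ j)) · v) x        ≈⟨ ⊗-· M (M ^ j) v x ⟩
    (M · ((M ^ j) · v)) x        ≈⟨ sum-cong-≋ (λ y → *-congˡ (^-eigen M v μ Mv≈μv j y)) ⟩
    (M · (λ y → pow μ j * v y)) x ≈⟨ ·-scale M (pow μ j) v x ⟩
    pow μ j * (M · v) x          ≈⟨ *-congˡ (Mv≈μv x) ⟩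
    pow μ j * (μ * v x)          ≈⟨ x∙yz≈y∙xz (pow μ j) μ (v x) ⟩
    μ * (pow μ j * v x)          ≈⟨ sym (*-assoc μ (pow μ j) (v x)) ⟩
    pow μ (suc j) * v x          ∎

  ^-no-walk : ∀ {n} (A : Fin n → Fin n → Bool) j x y → ¬ Walk A j x y → (toMatrix A ^ j) x y ≈ 0#
  ^-no-walk A zero    x y ¬walk = ⟦false⟧≈0 (dec-false (x Fin.≟ y) ¬walk)
  ^-no-walk A (suc j) x y ¬walk = sum-zero term
    where
    term : ∀ z → ⟦ A x z ⟧ * (toMatrix A ^ j) z y ≈ 0#
    term z with A x z in xz
    ... | false = zeroˡ _
    ... | true  = trans (*-congˡ (^-no-walk A j z y (λ zy → ¬walk (z , xz , zy)))) (zeroʳ 1#)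

  eval : ∀ {m} → (Fin m → Carrier) → Carrier → Carrier
  eval q t = sum (λ j → q j * pow t (toℕ j))

  eval-const : ∀ (q : Fin 1 → Carrier) t → eval q t ≈ q fzero
  eval-const q t = trans (+-identityʳ _) (*-identityʳ (q fzero))

  eval-zero : ∀ {m} (q : Fin m → Carrier) t → (∀ j → q j ≈ 0#) → eval q t ≈ 0#
  eval-zero q t q≈0 = sum-zero (λ j → trans (*-congʳ (q≈0 j)) (zeroˡ (pow t (toℕ j))))

  eval-horner : ∀ {d} (q : Fin (suc (suc d)) → Carrier) t → eval q t ≈ q fzero + t * eval (q ∘ fsuc) t
  eval-horner q t = +-cong (*-identityʳ (q fzero)) (begin
    sum (λ i → q (fsuc i) * (t * pow t (toℕ i))) ≈⟨ sum-cong-≋ (λ i → x∙yz≈y∙xz (q (fsuc i)) t (pow t (toℕ i))) ⟩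
    sum (λ i → t * (q (fsuc i) * pow t (toℕ i))) ≈⟨ sym (*-distribˡ-sum t (λ i → q (fsuc i) * pow t (toℕ i))) ⟩
    t * eval (q ∘ fsuc) t                        ∎)

  eval-tail-zero : ∀ {d} (q : Fin (suc (suc d)) → Carrier) t → (∀ i → q (fsuc i) ≈ 0#) → eval q t ≈ q fzero
  eval-tail-zero q t tail≈0 = begin
    eval q t                     ≈⟨ eval-horner q t ⟩
    q fzero + t * eval (q ∘ fsuc) t ≈⟨ +-congˡ (*-congˡ (eval-zero (q ∘ fsuc) t tail≈0)) ⟩
    q fzero + t * 0#             ≈⟨ +-congˡ (zeroʳ t) ⟩
    q fzero + 0#                 ≈⟨ +-identityʳ (q fzero) ⟩
    q fzero                      ∎

  x≈x-y+y : ∀ x y → x ≈ (x - y) + y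
  x≈x-y+y x y = sym (begin
    (x - y) + y   ≈⟨ +-assoc x (- y) y ⟩
    x + (- y + y) ≈⟨ +-congˡ (-‿inverseˡ y) ⟩
    x + 0#        ≈⟨ +-identityʳ x ⟩
    x             ∎)

  -- Synthetic division of q by (t - a); the remainder is eval q a.
  quot : ∀ {d} → Carrier → (Fin (suc (suc d)) → Carrier) → Fin (suc d) → Carrier
  quot {zero}  a q _        = q (fsuc fzero)
  quot {suc d} a q fzero    = eval (q ∘ fsuc) a
  quot {suc d} a q (fsuc i) = quot a (q ∘ fsuc) i

  factor-theorem : ∀ {d} a (q : Fin (suc (suc d)) → Carrier) t → eval q t ≈ (t - a) * eval (quot a q) t + eval q a
  factor-theorem {zero} a q t = begin
    eval q t                              ≈⟨ trans (eval-horner q t) (+-congˡ (*-congˡ (eval-const (q ∘ fsuc) t))) ⟩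
    q₀ + t * q₁                           ≈⟨ +-congˡ (*-congʳ (x≈x-y+y t a)) ⟩
    q₀ + ((t - a) + a) * q₁               ≈⟨ solve 4 (λ q₀ q₁ D a → q₀ :+ (D :+ a) :* q₁ := D :* q₁ :+ (q₀ :+ a :* q₁)) refl q₀ q₁ (t - a) a ⟩
    (t - a) * q₁ + (q₀ + a * q₁)          ≈⟨ sym (+-cong (*-congˡ (eval-const (quot a q) t))
                                                         (trans (eval-horner q a) (+-congˡ (*-congˡ (eval-const (q ∘ fsuc) a))))) ⟩
    (t - a) * eval (quot a q) t + eval q a ∎
    where
    q₀ q₁ : Carrier
    q₀ = q fzero
    q₁ = q (fsuc fzero)
  factor-theorem {suc d} a q t = begin
    eval q t                               ≈⟨ eval-horner q t ⟩
    q₀ + t * eval (q ∘ fsuc) t             ≈⟨ +-congˡ (*-congˡ (factor-theorem a (q ∘ fsuc) t)) ⟩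
    q₀ + t * ((t - a) * R + B)             ≈⟨ +-congˡ (*-congʳ (x≈x-y+y t a)) ⟩
    q₀ + ((t - a) + a) * ((t - a) * R + B) ≈⟨ solve 5 (λ q₀ D a R B → q₀ :+ (D :+ a) :* (D :* R :+ B)
                                                                   := D :* (B :+ (D :+ a) :* R) :+ (q₀ :+ a :* B)) refl q₀ (t - a) a R B ⟩
    (t - a) * (B + ((t - a) + a) * R) + (q₀ + a * B)
                                           ≈⟨ +-congʳ (*-congˡ (+-congˡ (*-congʳ (sym (x≈x-y+y t a))))) ⟩
    (t - a) * (B + t * R) + (q₀ + a * B)   ≈⟨ sym (+-cong (*-congˡ (eval-horner (quot a q) t)) (eval-horner q a)) ⟩
    (t - a) * eval (quot a q) t + eval q a ∎
    where
    q₀ R B : Carrier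
    q₀ = q fzero
    R = eval (quot a (q ∘ fsuc)) t
    B = eval (q ∘ fsuc) a

  quot-zero⇒tail-zero : ∀ {d} a (q : Fin (suc (suc d)) → Carrier) → (∀ i → quot a q i ≈ 0#) → ∀ i → q (fsuc i) ≈ 0#
  quot-zero⇒tail-zero {zero}  a q quot≈0 fzero    = quot≈0 fzero
  quot-zero⇒tail-zero {suc d} a q quot≈0 fzero    =
    trans (sym (eval-tail-zero (q ∘ fsuc) a (quot-zero⇒tail-zero a (q ∘ fsuc) (quot≈0 ∘ fsuc)))) (quot≈0 fzero)
  quot-zero⇒tail-zero {suc d} a q quot≈0 (fsuc i) = quot-zero⇒tail-zero a (q ∘ fsuc) (quot≈0 ∘ fsuc) i

  poly-eigen : ∀ {m n} (M : Matrix n) v μ → (∀ x → (M · v) x ≈ μ * v x) →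
    ∀ (cs : Fin m → Carrier) x → (lincomb cs (λ j → M ^ toℕ j) · v) x ≈ eval cs μ * v x
  poly-eigen M v μ Mv≈μv cs x = begin
    (lincomb cs (λ j → M ^ toℕ j) · v) x          ≈⟨ lincomb-· cs (λ j → M ^ toℕ j) v x ⟩
    sum (λ j → cs j * ((M ^ toℕ j) · v) x)       ≈⟨ sum-cong-≋ (λ j → *-congˡ {cs j} (^-eigen M v μ Mv≈μv (toℕ j) x)) ⟩
    sum (λ j → cs j * (pow μ (toℕ j) * v x))     ≈⟨ sum-cong-≋ (λ j → sym (*-assoc (cs j) (pow μ (toℕ j)) (v x))) ⟩
    sum (λ j → (cs j * pow μ (toℕ j)) * v x)     ≈⟨ sym (*-distribʳ-sum (v x) (λ j → cs j * pow μ (toℕ j))) ⟩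
    eval cs μ * v x                              ∎

  InSpan : ∀ {n d} → (Fin (suc d) → Fin n → Fin n → Bool) → Matrix n → Set (c ⊔ ℓ)
  InSpan {n} {d} Ai M = ∃ λ (β : Fin (suc d) → Carrier) → ∀ x y → M x y ≈ lincomb β (toMatrix ∘ Ai) x y

  module _ {n d} {Ai : Fin (suc d) → Fin n → Fin n → Bool} (S : IsCommAssocScheme n d Ai) where

    open IsCommAssocScheme S

    private
      As : Fin (suc d) → Matrix n
      As = toMatrix ∘ Ai

    𝕀∈span : InSpan Ai 𝕀
    𝕀∈span = 𝕀 fzero , λ x y →
      trans (sym (identity x y)) (sym (𝕀-· (λ k → toMatrix (Ai k) x y) fzero))

    ∈span-resp : ∀ {M N} → (∀ x y → M x y ≈ N x y) → InSpan Ai N → InSpan Ai M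
    ∈span-resp M≈N (β , N≈) = β , λ x y → trans (M≈N x y) (N≈ x y)

    lincomb∈span : ∀ {m} (γ : Fin m → Carrier) (Ms : Fin m → Matrix n) → (∀ k → InSpan Ai (Ms k)) →
      InSpan Ai (lincomb γ Ms)
    lincomb∈span {m} γ Ms Ms∈span = (λ r → sum (λ k → γ k * β k r)) , λ x y →
      trans (lincomb-congʳ γ Ms (λ k → lincomb (β k) As) x y (λ k → proj₂ (Ms∈span k) x y))
            (lincomb-lincomb γ β As x y)
      where
      β : Fin m → Fin (suc d) → Carrier
      β k = proj₁ (Ms∈span k)

    relation⊗∈span : ∀ k {N} → InSpan Ai N → InSpan Ai (As k ⊗ N)
    relation⊗∈span k {N} (β , N≈) =
      ∈span-resp (λ x y → trans (sum-cong-≋ (λ z → *-congˡ (N≈ z y))) (⊗-lincombʳ (As k) β As x y))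
                 (lincomb∈span β (λ l → As k ⊗ As l) (λ l → proj₁ (closed k l) , product l))
      where
      product : ∀ l x y → (As k ⊗ As l) x y ≈ lincomb (proj₁ (closed k l)) As x y
      product l x y = trans (sym (Σ≈sum n (λ z → As k x z * As l z y)))
                       (trans (proj₂ (closed k l) x y) (Σ≈sum (suc d) (λ r → proj₁ (closed k l) r * As r x y)))

    ⊗-closed : ∀ {M N} → InSpan Ai M → InSpan Ai N → InSpan Ai (M ⊗ N)
    ⊗-closed {M} {N} (γ , M≈) N∈span =
      ∈span-resp (λ x y → trans (sum-cong-≋ (λ z → *-congʳ (M≈ x z))) (⊗-lincombˡ γ As N x y))
                 (lincomb∈span γ (λ k → As k ⊗ N) (λ k → relation⊗∈span k N∈span))

    ^∈span : ∀ {M} → InSpan Ai M → ∀ j → InSpan Ai (M ^ j)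
    ^∈span M∈span zero    = 𝕀∈span
    ^∈span M∈span (suc j) = ⊗-closed M∈span (^∈span M∈span j)

    some-relation : ¬ (1# ≈ 0#) → ∀ x y → ∃ λ m → Ai m x y ≡ true
    some-relation 1≉0 x y with Fin.all? (λ k → Ai k x y Bool.≟ false)
    ... | yes all-false = ⊥-elim (1≉0 (begin
      1#                               ≈⟨ sym (sumJ x y) ⟩
      Σ[ suc d ] (λ k → ⟦ Ai k x y ⟧)  ≈⟨ Σ≈sum (suc d) (λ k → ⟦ Ai k x y ⟧) ⟩
      sum (λ k → ⟦ Ai k x y ⟧)         ≈⟨ sum-zero (λ k → ⟦false⟧≈0 (all-false k)) ⟩
      0#                               ∎))
    ... | no ¬all-false with Fin.¬∀⟶∃¬ _ _ (λ k → Ai k x y Bool.≟ false) ¬all-false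
    ...   | m , m≢false = m , Bool.¬-not m≢false

  Dependent : ∀ {m p} → (Fin m → Fin p → Carrier) → Set (c ⊔ ℓ)
  Dependent {m} v = ∃ λ (cs : Fin m → Carrier) → ¬ (∀ j → cs j ≈ 0#) × (∀ k → sum (λ j → cs j * v j k) ≈ 0#)

  Pivot : ∀ {m p} → (Fin (suc m) → Fin (suc p) → Carrier) → Set (c ⊔ ℓ)
  Pivot {m} v = ∃ λ j₀ → ∃ λ (r : Fin m → Carrier) → ∀ i → v (punchIn j₀ i) fzero ≈ r i * v j₀ fzero

  eliminate : ∀ {m p} (v : Fin (suc m) → Fin (suc p) → Carrier) j₀ (r : Fin m → Carrier) →
    (∀ i → v (punchIn j₀ i) fzero ≈ r i * v j₀ fzero) →
    Dependent (λ i k → v (punchIn j₀ i) (fsuc k) - r i * v j₀ (fsuc k)) → Dependent v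
  eliminate {m} {p} v j₀ r pivot (c′ , c′≉0 , c′-dep) = cs , cs≉0 , cs-dep
    where
    S : Carrier
    S = sum (λ i → c′ i * r i)

    cs : Fin (suc m) → Carrier
    cs = insertAt c′ j₀ (- S)

    cs≉0 : ¬ (∀ j → cs j ≈ 0#)
    cs≉0 cs≈0 = c′≉0 (λ i → trans (reflexive (≡.sym (insertAt-punchIn c′ j₀ (- S) i))) (cs≈0 (punchIn j₀ i)))

    reduced : Fin m → Fin (suc p) → Carrier
    reduced i fzero    = 0#
    reduced i (fsuc k) = v (punchIn j₀ i) (fsuc k) - r i * v j₀ (fsuc k)

    reduced-dep : ∀ k → sum (λ i → c′ i * reduced i k) ≈ 0#
    reduced-dep fzero    = sum-zero (λ i → zeroʳ (c′ i))
    reduced-dep (fsuc k) = c′-dep k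

    split : ∀ i k → v (punchIn j₀ i) k ≈ reduced i k + r i * v j₀ k
    split i fzero    = trans (pivot i) (sym (+-identityˡ _))
    split i (fsuc k) = x≈x-y+y _ _

    cs-dep : ∀ k → sum (λ j → cs j * v j k) ≈ 0#
    cs-dep k = begin
      sum (λ j → cs j * v j k)
        ≈⟨ sum-remove (λ j → cs j * v j k) ⟩
      cs j₀ * w + sum (λ i → cs (punchIn j₀ i) * v (punchIn j₀ i) k)
        ≈⟨ +-cong (*-congʳ (reflexive (insertAt-lookup c′ j₀ (- S))))
                  (sum-cong-≋ (λ i → *-cong (reflexive (insertAt-punchIn c′ j₀ (- S) i)) (split i k))) ⟩
      - S * w + sum (λ i → c′ i * (reduced i k + r i * w))
        ≈⟨ +-congˡ (sum-cong-≋ (λ i → trans (distribˡ (c′ i) _ _) (+-congˡ (sym (*-assoc (c′ i) (r i) w))))) ⟩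
      - S * w + sum (λ i → c′ i * reduced i k + (c′ i * r i) * w)
        ≈⟨ +-congˡ (∑-distrib-+ (λ i → c′ i * reduced i k) (λ i → (c′ i * r i) * w)) ⟩
      - S * w + (sum (λ i → c′ i * reduced i k) + sum (λ i → (c′ i * r i) * w))
        ≈⟨ +-cong (sym (-‿distribˡ-* S w)) (+-cong (reduced-dep k) (sym (*-distribʳ-sum w (λ i → c′ i * r i)))) ⟩
      - (S * w) + (0# + S * w)
        ≈⟨ +-congˡ (+-identityˡ (S * w)) ⟩
      - (S * w) + S * w
        ≈⟨ -‿inverseˡ (S * w) ⟩
      0# ∎
      where
      w : Carrier
      w = v j₀ k

  module _ (fld : IsField) where

    private
      1≉0 : ¬ (1# ≈ 0#)
      1≉0 = proj₁ fld

    x*y≈0⇒y≈0 : ∀ {x y} → ¬ (x ≈ 0#) → x * y ≈ 0# → y ≈ 0#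
    x*y≈0⇒y≈0 {x} {y} x≉0 xy≈0 with proj₂ fld x x≉0
    ... | x⁻¹ , xx⁻¹≈1 = begin
      y             ≈⟨ sym (*-identityˡ y) ⟩
      1# * y        ≈⟨ *-congʳ (trans (sym xx⁻¹≈1) (*-comm x x⁻¹)) ⟩
      (x⁻¹ * x) * y ≈⟨ *-assoc x⁻¹ x y ⟩
      x⁻¹ * (x * y) ≈⟨ *-congˡ xy≈0 ⟩
      x⁻¹ * 0#      ≈⟨ zeroʳ x⁻¹ ⟩
      0#            ∎

    roots⇒zero : ∀ {d} (q e : Fin (suc d) → Carrier) → (∀ i j → e i ≈ e j → i ≡ j) →
      (∀ k → eval q (e k) ≈ 0#) → ∀ j → q j ≈ 0#
    roots⇒zero {zero}  q e e-inj roots fzero = trans (sym (eval-const q (e fzero))) (roots fzero)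
    roots⇒zero {suc d} q e e-inj roots       = Fin.∀-cons head≈0 tail≈0
      where
      a : Carrier
      a = e fzero

      quot-roots : ∀ k → eval (quot a q) (e (fsuc k)) ≈ 0#
      quot-roots k = x*y≈0⇒y≈0 eₖ-a≉0 (begin
        (eₖ - a) * eval (quot a q) eₖ            ≈⟨ sym (+-identityʳ _) ⟩
        (eₖ - a) * eval (quot a q) eₖ + 0#       ≈⟨ +-congˡ (sym (roots fzero)) ⟩
        (eₖ - a) * eval (quot a q) eₖ + eval q a ≈⟨ sym (factor-theorem a q eₖ) ⟩
        eval q eₖ                                ≈⟨ roots (fsuc k) ⟩
        0#                                       ∎)
        where
        eₖ : Carrier
        eₖ = e (fsuc k)
        eₖ-a≉0 : ¬ (eₖ - a ≈ 0#)
        eₖ-a≉0 eₖ-a≈0 = Fin.0≢1+n (≡.sym (e-inj (fsuc k) fzero (x∙y⁻¹≈ε⇒x≈y eₖ a eₖ-a≈0)))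

      tail≈0 : ∀ i → q (fsuc i) ≈ 0#
      tail≈0 = quot-zero⇒tail-zero a q
        (roots⇒zero (quot a q) (e ∘ fsuc) (λ i j → Fin.suc-injective ∘ e-inj (fsuc i) (fsuc j)) quot-roots)

      head≈0 : q fzero ≈ 0#
      head≈0 = trans (sym (eval-tail-zero q a tail≈0)) (roots fzero)

    pivot : ∀ {m p} (v : Fin (suc m) → Fin (suc p) → Carrier) → ¬ ¬ Pivot v
    pivot v = ¬¬-map choose (¬¬-∀ (λ j → ¬¬-excluded-middle))
      where
      choose : (∀ j → Dec (v j fzero ≈ 0#)) → Pivot v
      choose v?≈0 with Fin.all? v?≈0
      ... | yes column≈0 = fzero , (λ _ → 0#) , λ i → trans (column≈0 (fsuc i)) (sym (zeroˡ _))
      ... | no ¬column≈0 with Fin.¬∀⟶∃¬ _ _ v?≈0 ¬column≈0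
      ...   | j₀ , p≉0 with proj₂ fld (v j₀ fzero) p≉0
      ...     | p⁻¹ , pp⁻¹≈1 = j₀ , (λ i → v (punchIn j₀ i) fzero * p⁻¹) , λ i → sym (begin
        (v (punchIn j₀ i) fzero * p⁻¹) * v j₀ fzero ≈⟨ *-assoc _ p⁻¹ (v j₀ fzero) ⟩
        v (punchIn j₀ i) fzero * (p⁻¹ * v j₀ fzero) ≈⟨ *-congˡ (trans (*-comm p⁻¹ _) pp⁻¹≈1) ⟩
        v (punchIn j₀ i) fzero * 1#                 ≈⟨ *-identityʳ _ ⟩
        v (punchIn j₀ i) fzero                      ∎)

    dependent : ∀ p (v : Fin (suc p) → Fin p → Carrier) → ¬ ¬ Dependent v
    dependent zero    v ¬dep = ¬dep ((λ _ → 1#) , (λ 1≈0 → 1≉0 (1≈0 fzero)) , λ ())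
    dependent (suc p) v ¬dep = pivot v λ (j₀ , r , column) →
      dependent p (λ i k → v (punchIn j₀ i) (fsuc k) - r i * v j₀ (fsuc k)) (¬dep ∘ eliminate v j₀ r column)

    kernel-dependent : ∀ p (v : Fin (suc p) → Fin (suc p) → Carrier) (w : Fin (suc p) → Carrier) m →
      ¬ (w m ≈ 0#) → (∀ j → sum (λ k → v j k * w k) ≈ 0#) → ¬ ¬ Dependent v
    kernel-dependent p v w m wₘ≉0 v∈ker = ¬¬-map extend (dependent p (λ j i → v j (punchIn m i)))
      where
      extend : Dependent (λ j i → v j (punchIn m i)) → Dependent v
      extend (cs , cs≉0 , cs-dep) = cs , cs≉0 , combination≈0
        where
        combination : Fin (suc p) → Carrier
        combination k = sum (λ j → cs j * v j k)

        off-m : ∀ k → k ≢ m → combination k ≈ 0#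
        off-m k k≢m = ≡.subst (λ k → combination k ≈ 0#) (Fin.punchIn-punchOut (k≢m ∘ ≡.sym)) (cs-dep (punchOut (k≢m ∘ ≡.sym)))

        at-m : combination m ≈ 0#
        at-m = x*y≈0⇒y≈0 wₘ≉0 (begin
          w m * combination m                        ≈⟨ *-comm (w m) (combination m) ⟩
          combination m * w m                        ≈⟨ sym (sum-single (λ k → combination k * w k) m
                                                             (λ k k≢m → trans (*-congʳ (off-m k k≢m)) (zeroˡ (w k)))) ⟩
          sum (λ k → combination k * w k)            ≈⟨ sym (∑-∑-assoc cs v w) ⟩
          sum (λ j → cs j * sum (λ k → v j k * w k)) ≈⟨ sum-zero (λ j → trans (*-congˡ (v∈ker j)) (zeroʳ (cs j))) ⟩
          0#                                         ∎)

        combination≈0 : ∀ k → combination k ≈ 0#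
        combination≈0 k with k Fin.≟ m
        ... | yes ≡.refl = at-m
        ... | no k≢m     = off-m k k≢m

    powers-independent : ∀ {n d} (A : Fin n → Fin n → Bool) → HasDistinctEigenvalues A (suc d) →
      ∀ (cs : Fin (suc d) → Carrier) → (∀ x y → lincomb cs (λ j → toMatrix A ^ toℕ j) x y ≈ 0#) →
      ¬ ¬ (∀ j → cs j ≈ 0#)
    powers-independent {n} A (e , e-inj , eigen , _) cs q[A]≈0 = ¬¬-map (roots⇒zero cs e e-inj) (¬¬-∀ root)
      where
      root : ∀ k → ¬ ¬ (eval cs (e k) ≈ 0#)
      root k q[eₖ]≉0 = v≉0 (λ x → x*y≈0⇒y≈0 q[eₖ]≉0 (begin
        eval cs (e k) * v x                          ≈⟨ sym (poly-eigen (toMatrix A) v (e k) Av≈eₖv cs x) ⟩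
        (lincomb cs (λ j → toMatrix A ^ toℕ j) · v) x ≈⟨ sum-zero (λ y → trans (*-congʳ (q[A]≈0 x y)) (zeroˡ (v y))) ⟩
        0#                                           ∎))
        where
        v : Fin n → Carrier
        v = proj₁ (eigen k)
        v≉0 : ¬ (∀ x → v x ≈ 0#)
        v≉0 = proj₁ (proj₂ (eigen k))
        Av≈eₖv : ∀ x → (toMatrix A · v) x ≈ e k * v x
        Av≈eₖv x = trans (sym (Σ≈sum n (λ y → ⟦ A x y ⟧ * v y))) (proj₂ (proj₂ (eigen k)) x)

    short-walk : ∀ {n d} {Ai : Fin (suc d) → Fin n → Fin n → Bool} → IsCommAssocScheme n d Ai →
      ∀ A → InBM Ai A → HasDistinctEigenvalues A (suc d) →
      ∀ x y → ¬ ¬ ∃ λ (j : Fin (suc d)) → Walk A (toℕ j) x y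
    short-walk {n} {d} {Ai} S A A∈BM distinct x y no-walk =
      kernel-dependent d β (λ k → As k x y) m (⟦true⟧≉0 1≉0 xy∈m) β∈ker
        λ (cs , cs≉0 , cs-dep) → powers-independent A distinct cs (annihilates cs cs-dep) cs≉0
      where
      As : Fin (suc d) → Matrix n
      As = toMatrix ∘ Ai

      m : Fin (suc d)
      m = proj₁ (some-relation S 1≉0 x y)

      xy∈m : Ai m x y ≡ true
      xy∈m = proj₂ (some-relation S 1≉0 x y)

      A∈span : InSpan Ai (toMatrix A)
      A∈span = proj₁ A∈BM , λ x y → trans (proj₂ A∈BM x y) (Σ≈sum (suc d) (λ k → proj₁ A∈BM k * As k x y))

      β : Fin (suc d) → Fin (suc d) → Carrier
      β j = proj₁ (^∈span S A∈span (toℕ j))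

      Aʲ≈ : ∀ j x y → (toMatrix A ^ toℕ j) x y ≈ lincomb (β j) As x y
      Aʲ≈ j = proj₂ (^∈span S A∈span (toℕ j))

      β∈ker : ∀ j → lincomb (β j) As x y ≈ 0#
      β∈ker j = trans (sym (Aʲ≈ j x y)) (^-no-walk A (toℕ j) x y (λ walk → no-walk (j , walk)))

      annihilates : ∀ cs → (∀ k → sum (λ j → cs j * β j k) ≈ 0#) →
        ∀ x′ y′ → lincomb cs (λ j → toMatrix A ^ toℕ j) x′ y′ ≈ 0#
      annihilates cs cs-dep x′ y′ = begin
        lincomb cs (λ j → toMatrix A ^ toℕ j) x′ y′
                                                    ≈⟨ lincomb-congʳ cs (λ j → toMatrix A ^ toℕ j) (λ j → lincomb (β j) As) x′ y′
                                                                     (λ j → Aʲ≈ j x′ y′) ⟩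
        lincomb cs (λ j → lincomb (β j) As) x′ y′   ≈⟨ lincomb-lincomb cs β As x′ y′ ⟩
        lincomb (λ k → sum (λ j → cs j * β j k)) As x′ y′
                                                    ≈⟨ sum-zero (λ k → trans (*-congʳ (cs-dep k)) (zeroˡ (As k x′ y′))) ⟩
        0#                                          ∎

    strongly-connected : ∀ {n d} {Ai : Fin (suc d) → Fin n → Fin n → Bool} → IsCommAssocScheme n d Ai →
      ∀ A → InBM Ai A → HasDistinctEigenvalues A (suc d) → StronglyConnected A
    strongly-connected S A A∈BM distinct x y =
      let j , walk = decidable-stable (Fin.any? (λ j → walk? A (toℕ j) x y)) (short-walk S A A∈BM distinct x y)
      in walk⇒reachable A (toℕ j) walk

corollary3p2 : ∀ {c ℓ : Level} (F : CommutativeRing c ℓ) →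
    Over.IsField F → Over.CharZero F → Over.AlgClosed F →
    ∀ (n d : ℕ) (Ai : Fin (suc d) → Fin n → Fin n → Bool) →
    Over.IsCommAssocScheme F n d Ai →
    ∀ (A : Fin n → Fin n → Bool) → Over.InBM F Ai A →
    Over.HasDistinctEigenvalues F A (suc d) →
    (Symmetric01 A → StronglyConnected A) × (¬ Symmetric01 A → StronglyConnected A)
corollary3p2 F F-field _ _ n d Ai S A A∈BM distinct = (λ _ → connected) , (λ _ → connected)
  where
  connected : StronglyConnected A
  connected = strongly-connected F F-field S A A∈BM distinct
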